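{- For every $\star$-structure $\mathbf H$, $\mathrm{Obs}^{\subset}_{01}(\mathbf H)=\mathrm{Obs}^{\to}_{01}(\mathbf H)$.
   Context: Fix a finite signature $\sigma$. Given a poset $(P,\preceq)$, a $(P,\sigma)$-structure $\mathbf G$ consists of a finite domain $G$ and, for each $R\in\sigma$ of arity $k$, a map $R^{\mathbf G}\colon G^k\to P$. A homomorphism $h\colon\mathbf G\to\mathbf H$ is a map $h\colon G\to H$ with $R^{\mathbf G}(\mathbf t)\preceq R^{\mathbf H}(h(\mathbf t))$ for all $R\in\sigma$ and tuples $\mathbf t$. $01$-structures are $(P_{01},\sigma)$-structures with $P_{01}=\{0,1\}$ ($0,1$ incomparable); $\star$-structures are $(P_\star,\sigma)$-structures with $P_\star=\{0,1,\star\}$, $0\preceq\star$, $1\preceq\star$, $0,1$ incomparable. A $01$-structure $\mathbf G$ is an inclusion-minimal obstruction for $\mathbf H$ if $\mathbf G\not\to\mathbf H$ and for every $v\in G$ the substructure induced by $G\setminus\{v\}$ maps to $\mathbf H$; $\mathrm{Obs}^\subset_{01}(\mathbf H)$ is the set of these. A $01$-structure $\mathbf G$ is a hom-minimal obstruction if $\mathbf G$ is a core (every endomorphism is an isomorphism), $\mathbf G\not\to\mathbf H$, and every $01$-structure $\mathbf G'$ with $\mathbf G'\to\mathbf G$ and $\mathbf G\not\to\mathbf G'$ satisfies $\mathbf G'\to\mathbf H$; $\mathrm{Obs}^\to_{01}(\mathbf H)$ is the set of these (up to isomorphism). -}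

module Defs where

open import Data.Nat using (ℕ; suc)
open import Data.Fin using (Fin; punchIn)
open import Data.Vec using (Vec; map)
open import Data.Bool using (Bool)
open import Data.Product using (Σ; _×_)
open import Relation.Binary.PropositionalEquality using (_≡_; subst; sym)
open import Relation.Nullary using (¬_)
open import Level using (0ℓ)

record Signature : Set where
  field
    size : ℕ
    arity : Fin size → ℕ
open Signature public

record Structure (σ : Signature) (P : Set) : Set where
  field
    dom : ℕ
    rel : (r : Fin (size σ)) → Vec (Fin dom) (arity σ r) → P
open Structure public

-- Homomorphisms, relative to a comparison relation _⊑_ between value sets
-- (for P = Q this is the poset order).
Hom : {σ : Signature} {P Q : Set} (_⊑_ : P → Q → Set) →
      (G : Structure σ P) (H : Structure σ Q) → (Fin (dom G) → Fin (dom H)) → Set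
Hom {σ} _⊑_ G H h =
  (r : Fin (size σ)) (t : Vec (Fin (dom G)) (arity σ r)) →
  _⊑_ (rel G r t) (rel H r (map h t))

_⟶[_]_ : {σ : Signature} {P Q : Set} → Structure σ P → (P → Q → Set) →
          Structure σ Q → Set
G ⟶[ _⊑_ ] H = Σ (Fin (dom G) → Fin (dom H)) (Hom _⊑_ G H)

data Star : Set where
  s0 s1 sT : Star

data _⪯★_ : Star → Star → Set where
  ⪯refl : ∀ {a} → a ⪯★ a
  0⪯T : s0 ⪯★ sT
  1⪯T : s1 ⪯★ sT

-- P01 = {0,1} (false = 0, true = 1), with 0,1 incomparable: order is equality.
embed01 : Bool → Star
embed01 Bool.false = s0
embed01 Bool.true = s1

_⊑01★_ : Bool → Star → Set
a ⊑01★ b = embed01 a ⪯★ b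

Str01 : Signature → Set
Str01 σ = Structure σ Bool

StrStar : Signature → Set
StrStar σ = Structure σ Star

_⟶01_ : {σ : Signature} → Str01 σ → Str01 σ → Set
G ⟶01 H = G ⟶[ _≡_ ] H

_⟶★_ : {σ : Signature} → Str01 σ → StrStar σ → Set
G ⟶★ H = G ⟶[ _⊑01★_ ] H

delete : {σ : Signature} {P : Set} (G : Structure σ P) (m : ℕ) →
         dom G ≡ suc m → Fin (dom G) → Structure σ P
delete {σ} {P} G m eq v = record { dom = m ; rel = λ r t → rel G r (map f t) }
  where
    f : Fin m → Fin (dom G)
    f i = subst Fin (sym eq) (punchIn (subst Fin eq v) i)

IsIso01 : {σ : Signature} (G : Str01 σ) → (Fin (dom G) → Fin (dom G)) → Set
IsIso01 G h = Σ (Fin (dom G) → Fin (dom G)) λ g →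
  Hom _≡_ G G g × ((x : Fin (dom G)) → g (h x) ≡ x) × ((x : Fin (dom G)) → h (g x) ≡ x)

IsCore01 : {σ : Signature} → Str01 σ → Set
IsCore01 G = (h : Fin (dom G) → Fin (dom G)) → Hom _≡_ G G h → IsIso01 G h

InclMinObs : {σ : Signature} → Str01 σ → StrStar σ → Set
InclMinObs G H =
  ¬ (G ⟶★ H) ×
  ((m : ℕ) (eq : dom G ≡ suc m) (v : Fin (dom G)) → delete G m eq v ⟶★ H)

HomMinObs : {σ : Signature} → Str01 σ → StrStar σ → Set
HomMinObs {σ} G H =
  IsCore01 G × ¬ (G ⟶★ H) ×
  ((G' : Str01 σ) → G' ⟶01 G → ¬ (G ⟶01 G') → G' ⟶★ H)

{-# OPTIONS --safe #-}
module Submission where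

-- A homomorphism G' → G either misses some vertex v, and then factors through
-- G ∖ {v}, or is surjective, and then any section is a homomorphism G → G'.
-- Hence for an inclusion-minimal obstruction G every endomorphism is surjective,
-- so bijective, and G is a core; and a G' below G but not above it cannot map
-- onto G, so it maps into some G ∖ {v} and thus to H. Conversely, if G is a core,
-- G ∖ {v} ↪ G is strictly below G, since G → G ∖ {v} ↪ G would be a
-- non-surjective endomorphism.

open import Defs
open import Data.Nat using (ℕ; suc)
open import Data.Fin using (Fin; zero; suc; punchIn; punchOut)
open import Data.Fin.Properties using (any?; all?; ¬∀⟶∃¬; punchInᵢ≢i; punchIn-punchOut; _≟_)
open import Data.Vec using (map)
open import Data.Vec.Properties using (map-∘; map-cong; map-id)
open import Data.Product using (Σ; _,_; proj₁; proj₂)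
open import Data.Sum using (_⊎_; inj₁; inj₂)
open import Data.Empty using (⊥-elim)
open import Function using (_∘_)
open import Function.Bundles using (_⇔_; mk⇔)
open import Function.Definitions using (StrictlySurjective)
open import Relation.Nullary using (¬_; yes; no)
open import Relation.Binary.PropositionalEquality

private
  variable
    n m k : ℕ

inhabited⇒suc : Fin n → Σ ℕ λ m → n ≡ suc m
inhabited⇒suc (zero {n}) = n , refl
inhabited⇒suc (suc {n} _) = n , refl

skip : n ≡ suc m → Fin n → Fin m → Fin n
skip eq v i = subst Fin (sym eq) (punchIn (subst Fin eq v) i)

skip-≢ : (eq : n ≡ suc m) (v : Fin n) (i : Fin m) → skip eq v i ≢ v
skip-≢ refl v i = punchInᵢ≢i v i

skip-covers : (eq : n ≡ suc m) (v x : Fin n) → x ≢ v → Σ (Fin m) λ i → skip eq v i ≡ x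
skip-covers refl v x x≢v = punchOut (x≢v ∘ sym) , punchIn-punchOut _

misses-or-surjective : (h : Fin n → Fin k) →
  (Σ (Fin k) λ v → ∀ x → h x ≢ v) ⊎ StrictlySurjective _≡_ h
misses-or-surjective {k = k} h with all? (λ y → any? (λ x → h x ≟ y))
... | yes onto = inj₂ onto
... | no ¬onto with ¬∀⟶∃¬ k _ (λ y → any? (λ x → h x ≟ y)) ¬onto
...   | v , v∉im = inj₁ (v , λ x hx≡v → v∉im (x , hx≡v))

section-surjective⇒inverseˡ : {A B : Set} (h : A → B) (g : B → A) →
  (∀ y → h (g y) ≡ y) → StrictlySurjective _≡_ g → ∀ x → g (h x) ≡ x
section-surjective⇒inverseˡ h g hg≗id g-onto x = begin
    g (h x)         ≡⟨ cong (g ∘ h) (sym gy≡x) ⟩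
    g (h (g y))     ≡⟨ cong g (hg≗id y) ⟩
    g y             ≡⟨ gy≡x ⟩
    x               ∎
  where
    open ≡-Reasoning
    y = proj₁ (g-onto x)
    gy≡x = proj₂ (g-onto x)

module _ {σ : Signature} {P : Set} where

  ⟶-∘ : {Q : Set} {_⊑_ : P → Q → Set} {G' G : Structure σ P} {H : Structure σ Q} →
    G' ⟶[ _≡_ ] G → G ⟶[ _⊑_ ] H → G' ⟶[ _⊑_ ] H
  ⟶-∘ {_⊑_ = _⊑_} {H = H} (h , h-hom) (g , g-hom) = g ∘ h , λ r t →
    subst₂ _⊑_ (sym (h-hom r t)) (cong (rel H r) (sym (map-∘ g h t))) (g-hom r (map h t))

  delete↪ : (G : Structure σ P) (m : ℕ) (eq : dom G ≡ suc m) (v : Fin (dom G)) →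
    delete G m eq v ⟶[ _≡_ ] G
  delete↪ G m eq v = skip eq v , λ r t → refl

  ⟶delete : {G' G : Structure σ P} (h : Fin (dom G') → Fin (dom G)) → Hom _≡_ G' G h →
    (m : ℕ) (eq : dom G ≡ suc m) (v : Fin (dom G)) → (∀ x → h x ≢ v) →
    G' ⟶[ _≡_ ] delete G m eq v
  ⟶delete {G = G} h h-hom m eq v misses = h' , λ r t → trans (h-hom r t)
      (cong (rel G r) (trans (map-cong (sym ∘ skip∘h'≡h) t) (map-∘ (skip eq v) h' t)))
    where
      h' : _ → Fin m
      h' x = proj₁ (skip-covers eq v (h x) (misses x))
      skip∘h'≡h : ∀ x → skip eq v (h' x) ≡ h x
      skip∘h'≡h x = proj₂ (skip-covers eq v (h x) (misses x))

  section-Hom : {G' G : Structure σ P} (h : Fin (dom G') → Fin (dom G)) → Hom _≡_ G' G h →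
    (onto : StrictlySurjective _≡_ h) → Hom _≡_ G G' (proj₁ ∘ onto)
  section-Hom {G'} {G} h h-hom onto r t = sym (begin
      rel G' r (map s t)          ≡⟨ h-hom r (map s t) ⟩
      rel G r (map h (map s t))   ≡⟨ cong (rel G r) (sym (map-∘ h s t)) ⟩
      rel G r (map (h ∘ s) t)     ≡⟨ cong (rel G r) (map-cong (proj₂ ∘ onto) t) ⟩
      rel G r (map (λ y → y) t)   ≡⟨ cong (rel G r) (map-id t) ⟩
      rel G r t                   ∎)
    where
      open ≡-Reasoning
      s = proj₁ ∘ onto

module _ {σ : Signature} {G : Str01 σ} {H : StrStar σ} where

  AllDeletions⟶★ : Set
  AllDeletions⟶★ = (m : ℕ) (eq : dom G ≡ suc m) (v : Fin (dom G)) → delete G m eq v ⟶★ H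

  surjective-or-⟶★ : AllDeletions⟶★ → {G' : Str01 σ} (h : Fin (dom G') → Fin (dom G)) →
    Hom _≡_ G' G h → StrictlySurjective _≡_ h ⊎ G' ⟶★ H
  surjective-or-⟶★ deletions⟶★ h h-hom with misses-or-surjective h
  ... | inj₂ onto = inj₁ onto
  ... | inj₁ (v , misses) with inhabited⇒suc v
  ...   | m , eq = inj₂ (⟶-∘ {_⊑_ = _⊑01★_} {G = delete G m eq v} {H = H}
                         (⟶delete {G = G} h h-hom m eq v misses) (deletions⟶★ m eq v))

  InclMinObs⇒endo-surjective : InclMinObs G H → (h : Fin (dom G) → Fin (dom G)) →
    Hom _≡_ G G h → StrictlySurjective _≡_ h
  InclMinObs⇒endo-surjective (G↛H , deletions⟶★) h h-hom
    with surjective-or-⟶★ deletions⟶★ h h-hom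
  ... | inj₁ onto = onto
  ... | inj₂ G⟶H = ⊥-elim (G↛H G⟶H)

  InclMinObs⇒IsCore01 : InclMinObs G H → IsCore01 G
  InclMinObs⇒IsCore01 obs h h-hom =
    g , g-hom , section-surjective⇒inverseˡ h g hg≗id g-onto , hg≗id
    where
      h-onto = InclMinObs⇒endo-surjective obs h h-hom
      g = proj₁ ∘ h-onto
      hg≗id = proj₂ ∘ h-onto
      g-hom = section-Hom h h-hom h-onto
      g-onto = InclMinObs⇒endo-surjective obs g g-hom

  InclMinObs⇒HomMinObs : InclMinObs G H → HomMinObs G H
  InclMinObs⇒HomMinObs obs@(G↛H , deletions⟶★) = InclMinObs⇒IsCore01 obs , G↛H , below⟶★
    where
      below⟶★ : (G' : Str01 σ) → G' ⟶01 G → ¬ (G ⟶01 G') → G' ⟶★ H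
      below⟶★ G' (h , h-hom) G↛G' with surjective-or-⟶★ deletions⟶★ h h-hom
      ... | inj₁ onto = ⊥-elim (G↛G' (proj₁ ∘ onto , section-Hom h h-hom onto))
      ... | inj₂ G'⟶H = G'⟶H

  IsCore01⇒↛delete : IsCore01 G → (m : ℕ) (eq : dom G ≡ suc m) (v : Fin (dom G)) →
    ¬ (G ⟶01 delete G m eq v)
  IsCore01⇒↛delete core m eq v G⟶G∖v = skip-≢ eq v (proj₁ G⟶G∖v (g v)) (e∘g≗id v)
    where
      endo : G ⟶01 G
      endo = ⟶-∘ {_⊑_ = _≡_} {G = delete G m eq v} {H = G} G⟶G∖v (delete↪ G m eq v)
      iso : IsIso01 G (proj₁ endo)
      iso = core (proj₁ endo) (proj₂ endo)
      g = proj₁ iso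
      e∘g≗id = proj₂ (proj₂ (proj₂ iso))

  HomMinObs⇒InclMinObs : HomMinObs G H → InclMinObs G H
  HomMinObs⇒InclMinObs (core , G↛H , below⟶★) = G↛H , λ m eq v →
    below⟶★ (delete G m eq v) (delete↪ G m eq v) (IsCore01⇒↛delete core m eq v)

mainTheorem11 : (σ : Signature) (H : StrStar σ) (G : Str01 σ) →
    InclMinObs G H ⇔ HomMinObs G H
mainTheorem11 σ H G = mk⇔ (InclMinObs⇒HomMinObs {G = G} {H}) (HomMinObs⇒InclMinObs {G = G} {H})
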